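{- Let $n \ge 1$ be an integer and let $T(n)$ denote the number of nodes of the game tree of e-Valuate for an arithmetic expression with $n$ variables (described in the context), and set $T(0)=1$. Then $T(n)$ depends only on $n$ and satisfies \[ T(n) = 11 + 10\,n\,T(n-1), \] and moreover \[ 2\, n!\, 10^n \;\le\; T(n) \;\le\; 2\, n!\, 10^n\, e^{1/10}. \]
   Context: e-Valuate is played on an arithmetic expression $E$ with $n$ distinct variables. Two players alternate: the maximizer (MAX) proposes a digit in $\{0,1,\dots,9\}$, and then the minimizer (MIN) substitutes that digit for one of the variables not yet instantiated; the game ends after $n$ such rounds, when all variables are instantiated. The game tree of $E$ is the rooted tree of height $2n$ whose nodes are the game positions: the root is the uninstantiated expression. Levels alternate between MAX nodes and MIN nodes, with the root and the leaves (at height $0$) being MAX nodes. A MAX node at height $d>0$ is a partially instantiated expression with $d/2$ uninstantiated variables and has exactly $10$ children, one MIN node for each digit choice; a MIN node at height $d$ is a pair (partially instantiated expression with $(d+1)/2$ uninstantiated variables, proposed digit) and has exactly $(d+1)/2$ children, one MAX node for each choice of uninstantiated variable to receive the digit. A game tree with $0$ variables consists of a single node. -}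

module Defs where

open import Data.Nat using (ℕ; zero; suc; _+_; _*_)
open import Data.Fin using (Fin; punchOut; _≟_)
open import Data.List using (List; []; map; allFin)
open import Data.Integer using (+_)
open import Data.Rational using (ℚ; _/_; 1ℚ)
import Data.Rational as Q
open import Relation.Nullary using (yes; no)

data Expr (V : Set) : Set where
  var  : V → Expr V
  lit  : Fin 10 → Expr V
  _⊕_ _⊖_ _⊗_ _⊘_ : Expr V → Expr V → Expr V

data Occurs {V : Set} (x : V) : Expr V → Set where
  here : Occurs x (var x)
  ⊕ˡ : ∀ {a b} → Occurs x a → Occurs x (a ⊕ b)
  ⊕ʳ : ∀ {a b} → Occurs x b → Occurs x (a ⊕ b)
  ⊖ˡ : ∀ {a b} → Occurs x a → Occurs x (a ⊖ b)
  ⊖ʳ : ∀ {a b} → Occurs x b → Occurs x (a ⊖ b)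
  ⊗ˡ : ∀ {a b} → Occurs x a → Occurs x (a ⊗ b)
  ⊗ʳ : ∀ {a b} → Occurs x b → Occurs x (a ⊗ b)
  ⊘ˡ : ∀ {a b} → Occurs x a → Occurs x (a ⊘ b)
  ⊘ʳ : ∀ {a b} → Occurs x b → Occurs x (a ⊘ b)

HasExactlyVars : (n : ℕ) → Expr (Fin n) → Set
HasExactlyVars n e = (x : Fin n) → Occurs x e

inst : ∀ {k} → Fin (suc k) → Fin 10 → Expr (Fin (suc k)) → Expr (Fin k)
inst x d (var y) with x ≟ y
... | yes _  = lit d
... | no x≢y = var (punchOut x≢y)
inst x d (lit c) = lit c
inst x d (a ⊕ b) = inst x d a ⊕ inst x d b
inst x d (a ⊖ b) = inst x d a ⊖ inst x d b
inst x d (a ⊗ b) = inst x d a ⊗ inst x d b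
inst x d (a ⊘ b) = inst x d a ⊘ inst x d b

data Tree : Set where
  node : List Tree → Tree

mutual
  size : Tree → ℕ
  size (node ts) = suc (sizes ts)

  sizes : List Tree → ℕ
  sizes [] = 0
  sizes (t Data.List.∷ ts) = size t + sizes ts

-- The game tree. maxNode k e : MAX position with k uninstantiated variables;
-- minNode k e d : MIN position (e with k+1 uninstantiated variables, proposed digit d).
mutual
  maxNode : (k : ℕ) → Expr (Fin k) → Tree
  maxNode zero    e = node []
  maxNode (suc k) e = node (map (minNode k e) (allFin 10))

  minNode : (k : ℕ) → Expr (Fin (suc k)) → Fin 10 → Tree
  minNode k e d = node (map (λ x → maxNode k (inst x d e)) (allFin (suc k)))

gameTree : (n : ℕ) → Expr (Fin n) → Tree
gameTree = maxNode

nodes : (n : ℕ) → Expr (Fin n) → ℕ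
nodes n e = size (gameTree n e)

-- Partial sums of the exponential series at 1/10:
-- expTenth N = Σ_{k=0}^{N} (1/10)^k / k!   (these increase to e^{1/10}).
expTerm : ℕ → ℚ
expTerm zero    = 1ℚ
expTerm (suc k) = expTerm k Q.* ((+ 1) / (10 * suc k))

expTenth : ℕ → ℚ
expTenth zero    = 1ℚ
expTenth (suc N) = expTenth N Q.+ expTerm (suc N)

toℚ : ℕ → ℚ
toℚ m = (+ m) / 1

-- A MAX node with k free variables has 10 MIN children, each with k MAX
-- children with k − 1 free variables, so the size T k of a MAX subtree
-- depends on k alone and T (k+1) = 1 + 10 (1 + (k+1) T k).  Writing
-- D k = k! 10^k and N k = D k · Σ_{j≤k} 1/(j! 10^j), the three sequences
-- obey the same recurrence with multiplier 10 (k+1): D by pure scaling,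
-- N with the added constant 1, T with 11.  Comparing the constants gives
-- 2 D n ≤ T n for n ≥ 1 and T n < 2 N n for all n.
module Submission where

open import Defs
open import Data.Nat using (ℕ; zero; suc; s≤s; z≤n; _+_; _*_; _^_; _≤_; _<_; _∸_; _!; NonZero)
open import Data.Nat.Properties
  using (*-suc; *-assoc; *-distribˡ-+; *-monoʳ-≤; +-monoʳ-≤; +-monoˡ-≤;
         m≤n+m; n≤1+n; ≤-refl; <⇒≤; *-commutativeSemigroup; module ≤-Reasoning)
open import Data.Nat.Tactic.RingSolver using (solve-∀)
open import Data.Fin using (Fin)
open import Data.List using (List; []; _∷_; map; allFin; length)
open import Data.List.Properties using (length-tabulate)
open import Data.Product using (Σ; _×_; ∃-syntax; _,_)
import Data.Integer as ℤ
import Data.Integer.Properties as ℤ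
open import Data.Rational using (1ℚ; toℚᵘ; fromℚᵘ)
import Data.Rational as Q
import Data.Rational.Properties as Q
open import Data.Rational.Unnormalised using (ℚᵘ; mkℚᵘ; *≡*; *≤*)
import Data.Rational.Unnormalised as ℚᵘ
import Data.Rational.Unnormalised.Properties as ℚᵘ
open import Algebra.Bundles using (CommutativeMonoid)
import Algebra.Properties.CommutativeSemigroup as CommSemigroupProperties
open import Relation.Binary.PropositionalEquality
  using (_≡_; refl; sym; trans; cong; cong₂; subst; module ≡-Reasoning)

fromℚᵘ-homo-+ : ∀ p q → fromℚᵘ (p ℚᵘ.+ q) ≡ fromℚᵘ p Q.+ fromℚᵘ q
fromℚᵘ-homo-+ p q = Q.toℚᵘ-injective (begin
  toℚᵘ (fromℚᵘ (p ℚᵘ.+ q))                 ≈⟨ Q.toℚᵘ-fromℚᵘ (p ℚᵘ.+ q) ⟩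
  p ℚᵘ.+ q                                 ≈⟨ ℚᵘ.+-cong (ℚᵘ.≃-sym (Q.toℚᵘ-fromℚᵘ p))
                                                 (ℚᵘ.≃-sym (Q.toℚᵘ-fromℚᵘ q)) ⟩
  toℚᵘ (fromℚᵘ p) ℚᵘ.+ toℚᵘ (fromℚᵘ q)     ≈⟨ Q.toℚᵘ-homo-+ (fromℚᵘ p) (fromℚᵘ q) ⟨
  toℚᵘ (fromℚᵘ p Q.+ fromℚᵘ q)             ∎)
  where open ℚᵘ.≃-Reasoning

fromℚᵘ-homo-* : ∀ p q → fromℚᵘ (p ℚᵘ.* q) ≡ fromℚᵘ p Q.* fromℚᵘ q
fromℚᵘ-homo-* p q = Q.toℚᵘ-injective (begin
  toℚᵘ (fromℚᵘ (p ℚᵘ.* q))                 ≈⟨ Q.toℚᵘ-fromℚᵘ (p ℚᵘ.* q) ⟩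
  p ℚᵘ.* q                                 ≈⟨ ℚᵘ.*-cong (ℚᵘ.≃-sym (Q.toℚᵘ-fromℚᵘ p))
                                                 (ℚᵘ.≃-sym (Q.toℚᵘ-fromℚᵘ q)) ⟩
  toℚᵘ (fromℚᵘ p) ℚᵘ.* toℚᵘ (fromℚᵘ q)     ≈⟨ Q.toℚᵘ-homo-* (fromℚᵘ p) (fromℚᵘ q) ⟨
  toℚᵘ (fromℚᵘ p Q.* fromℚᵘ q)             ∎)
  where open ℚᵘ.≃-Reasoning

fromℚᵘ-mono-≤ : ∀ {p q} → p ℚᵘ.≤ q → fromℚᵘ p Q.≤ fromℚᵘ q
fromℚᵘ-mono-≤ {p} {q} p≤q = Q.toℚᵘ-cancel-≤
  (ℚᵘ.≤-respˡ-≃ (ℚᵘ.≃-sym (Q.toℚᵘ-fromℚᵘ p))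
  (ℚᵘ.≤-respʳ-≃ (ℚᵘ.≃-sym (Q.toℚᵘ-fromℚᵘ q)) p≤q))

fromℕᵘ : ℕ → ℚᵘ
fromℕᵘ m = mkℚᵘ (ℤ.+ m) 0

fromℕᵘ-+ : ∀ m n → fromℕᵘ (m + n) ℚᵘ.≃ fromℕᵘ m ℚᵘ.+ fromℕᵘ n
fromℕᵘ-+ m n = *≡* (cong (ℤ._* ℤ.+ 1)
  (trans (ℤ.pos-+ m n) (sym (cong₂ ℤ._+_ (ℤ.*-identityʳ (ℤ.+ m)) (ℤ.*-identityʳ (ℤ.+ n))))))

fromℕᵘ-* : ∀ m n → fromℕᵘ (m * n) ℚᵘ.≃ fromℕᵘ m ℚᵘ.* fromℕᵘ n
fromℕᵘ-* m n = *≡* (cong (ℤ._* ℤ.+ 1) (ℤ.pos-* m n))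

fromℕᵘ-mono-≤ : ∀ {m n} → m ≤ n → fromℕᵘ m ℚᵘ.≤ fromℕᵘ n
fromℕᵘ-mono-≤ m≤n = *≤* (ℤ.*-monoʳ-≤-nonNeg (ℤ.+ 1) (ℤ.+≤+ m≤n))

-- toℚ m = fromℚᵘ (fromℕᵘ m) and (+ 1) / suc d = fromℚᵘ (mkℚᵘ (+ 1) d) hold by definition.

toℚ-+ : ∀ m n → toℚ (m + n) ≡ toℚ m Q.+ toℚ n
toℚ-+ m n = trans (Q.fromℚᵘ-cong (fromℕᵘ-+ m n)) (fromℚᵘ-homo-+ (fromℕᵘ m) (fromℕᵘ n))

toℚ-* : ∀ m n → toℚ (m * n) ≡ toℚ m Q.* toℚ n
toℚ-* m n = trans (Q.fromℚᵘ-cong (fromℕᵘ-* m n)) (fromℚᵘ-homo-* (fromℕᵘ m) (fromℕᵘ n))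

toℚ-mono-≤ : ∀ {m n} → m ≤ n → toℚ m Q.≤ toℚ n
toℚ-mono-≤ m≤n = fromℚᵘ-mono-≤ (fromℕᵘ-mono-≤ m≤n)

toℚ-*-inverse : ∀ n .{{_ : NonZero n}} → toℚ n Q.* ((ℤ.+ 1) Q./ n) ≡ 1ℚ
toℚ-*-inverse (suc d) = trans (sym (fromℚᵘ-homo-* (fromℕᵘ (suc d)) (mkℚᵘ (ℤ.+ 1) d)))
                              (Q.fromℚᵘ-cong (ℚᵘ.*-inverseʳ (fromℕᵘ (suc d))))

sizes-map-allFin : ∀ {n} (f : Fin n → Tree) {c} → (∀ i → size (f i) ≡ c) →
                   sizes (map f (allFin n)) ≡ n * c
sizes-map-allFin {n} f {c} size-f≡c =
  trans (go (allFin n)) (cong (_* c) (length-tabulate {n = n} (λ i → i)))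
  where
  go : (is : List (Fin n)) → sizes (map f is) ≡ length is * c
  go []       = refl
  go (i ∷ is) = cong₂ _+_ (size-f≡c i) (go is)

gameTreeSize : ℕ → ℕ
gameTreeSize zero    = 1
gameTreeSize (suc k) = 11 + 10 * suc k * gameTreeSize k

expTenthDenom : ℕ → ℕ
expTenthDenom zero    = 1
expTenthDenom (suc k) = 10 * suc k * expTenthDenom k

expTenthNumer : ℕ → ℕ
expTenthNumer zero    = 1
expTenthNumer (suc k) = 1 + 10 * suc k * expTenthNumer k

mutual
  size-maxNode : ∀ k e → size (maxNode k e) ≡ gameTreeSize k
  size-maxNode zero    e = refl
  size-maxNode (suc k) e = cong suc (begin
    sizes (map (minNode k e) (allFin 10)) ≡⟨ sizes-map-allFin (minNode k e) (size-minNode k e) ⟩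
    10 * suc (suc k * gameTreeSize k)     ≡⟨ *-suc 10 _ ⟩
    10 + 10 * (suc k * gameTreeSize k)    ≡⟨ cong (10 +_) (sym (*-assoc 10 (suc k) _)) ⟩
    10 + 10 * suc k * gameTreeSize k      ∎)
    where open ≡-Reasoning

  size-minNode : ∀ k e d → size (minNode k e d) ≡ suc (suc k * gameTreeSize k)
  size-minNode k e d =
    cong suc (sizes-map-allFin _ (λ x → size-maxNode k (inst x d e)))

open CommSemigroupProperties *-commutativeSemigroup using (x∙yz≈y∙xz)

2*expTenthDenom≤gameTreeSize : ∀ m → 2 * expTenthDenom (suc m) ≤ gameTreeSize (suc m)
2*expTenthDenom≤gameTreeSize zero    = n≤1+n 20
2*expTenthDenom≤gameTreeSize (suc m) = begin
  2 * (c * expTenthDenom k) ≡⟨ x∙yz≈y∙xz 2 c (expTenthDenom k) ⟩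
  c * (2 * expTenthDenom k) ≤⟨ *-monoʳ-≤ c (2*expTenthDenom≤gameTreeSize m) ⟩
  c * gameTreeSize k        ≤⟨ m≤n+m _ 11 ⟩
  11 + c * gameTreeSize k   ∎
  where
  open ≤-Reasoning
  k = suc m
  c = 10 * suc k

gameTreeSize<2*expTenthNumer : ∀ n → gameTreeSize n < 2 * expTenthNumer n
gameTreeSize<2*expTenthNumer zero    = ≤-refl
gameTreeSize<2*expTenthNumer (suc k) = begin
  2 + (10 + c * gameTreeSize k)  ≤⟨ +-monoʳ-≤ 2 (+-monoˡ-≤ (c * gameTreeSize k) 10≤c) ⟩
  2 + (c + c * gameTreeSize k)   ≡⟨ cong (2 +_) (sym (*-suc c _)) ⟩
  2 + c * suc (gameTreeSize k)   ≤⟨ +-monoʳ-≤ 2 (*-monoʳ-≤ c (gameTreeSize<2*expTenthNumer k)) ⟩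
  2 + c * (2 * expTenthNumer k)  ≡⟨ cong (2 +_) (x∙yz≈y∙xz c 2 (expTenthNumer k)) ⟩
  2 + 2 * (c * expTenthNumer k)  ≡⟨ sym (*-distribˡ-+ 2 1 _) ⟩
  2 * (1 + c * expTenthNumer k)  ∎
  where
  open ≤-Reasoning
  c = 10 * suc k
  10≤c : 10 ≤ c
  10≤c = *-monoʳ-≤ 10 (s≤s (z≤n {k}))

expTenthDenom≡!*10^ : ∀ n → expTenthDenom n ≡ n ! * 10 ^ n
expTenthDenom≡!*10^ zero    = refl
expTenthDenom≡!*10^ (suc k) = trans (cong (10 * suc k *_) (expTenthDenom≡!*10^ k))
                                     (rearrange (suc k) (k !) (10 ^ k))
  where
  rearrange : ∀ s a b → 10 * s * (a * b) ≡ s * a * (10 * b)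
  rearrange = solve-∀

open CommSemigroupProperties (CommutativeMonoid.commutativeSemigroup Q.*-1-commutativeMonoid)
  using (interchange)

expTenthDenom-*-expTerm : ∀ k → toℚ (expTenthDenom k) Q.* expTerm k ≡ 1ℚ
expTenthDenom-*-expTerm zero    = refl
expTenthDenom-*-expTerm (suc k) = begin
  toℚ (c * D) Q.* (expTerm k Q.* r)            ≡⟨ cong (Q._* (expTerm k Q.* r)) (toℚ-* c D) ⟩
  (toℚ c Q.* toℚ D) Q.* (expTerm k Q.* r)      ≡⟨ cong (Q._* (expTerm k Q.* r)) (Q.*-comm (toℚ c) (toℚ D)) ⟩
  (toℚ D Q.* toℚ c) Q.* (expTerm k Q.* r)      ≡⟨ interchange (toℚ D) (toℚ c) (expTerm k) r ⟩
  (toℚ D Q.* expTerm k) Q.* (toℚ c Q.* r)      ≡⟨ cong₂ Q._*_ (expTenthDenom-*-expTerm k) (toℚ-*-inverse c) ⟩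
  1ℚ Q.* 1ℚ                                    ≡⟨⟩
  1ℚ                                           ∎
  where
  open ≡-Reasoning
  c = 10 * suc k
  D = expTenthDenom k
  r = (ℤ.+ 1) Q./ c

expTenthDenom-*-expTenth : ∀ k → toℚ (expTenthDenom k) Q.* expTenth k ≡ toℚ (expTenthNumer k)
expTenthDenom-*-expTenth zero    = refl
expTenthDenom-*-expTenth (suc k) = begin
  toℚ D′ Q.* (expTenth k Q.+ expTerm (suc k))            ≡⟨ Q.*-distribˡ-+ (toℚ D′) (expTenth k) _ ⟩
  toℚ D′ Q.* expTenth k Q.+ toℚ D′ Q.* expTerm (suc k)   ≡⟨ cong₂ Q._+_ (cong (Q._* expTenth k) (toℚ-* c D))
                                                                       (expTenthDenom-*-expTerm (suc k)) ⟩
  (toℚ c Q.* toℚ D) Q.* expTenth k Q.+ 1ℚ                ≡⟨ cong (Q._+ 1ℚ) (Q.*-assoc (toℚ c) (toℚ D) (expTenth k)) ⟩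
  toℚ c Q.* (toℚ D Q.* expTenth k) Q.+ 1ℚ                ≡⟨ cong (λ x → toℚ c Q.* x Q.+ 1ℚ) (expTenthDenom-*-expTenth k) ⟩
  toℚ c Q.* toℚ N Q.+ 1ℚ                                 ≡⟨ Q.+-comm (toℚ c Q.* toℚ N) 1ℚ ⟩
  1ℚ Q.+ toℚ c Q.* toℚ N                                 ≡⟨ cong (1ℚ Q.+_) (sym (toℚ-* c N)) ⟩
  toℚ 1 Q.+ toℚ (c * N)                                  ≡⟨ sym (toℚ-+ 1 (c * N)) ⟩
  toℚ (1 + c * N)                                        ∎
  where
  open ≡-Reasoning
  c = 10 * suc k
  D = expTenthDenom k
  D′ = expTenthDenom (suc k)
  N = expTenthNumer k

gameTreeSize≤expTenthBound : ∀ n →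
                             toℚ (gameTreeSize n) Q.≤ toℚ (2 * expTenthDenom n) Q.* expTenth n
gameTreeSize≤expTenthBound n = begin
  toℚ (gameTreeSize n)                             ≤⟨ toℚ-mono-≤ (<⇒≤ (gameTreeSize<2*expTenthNumer n)) ⟩
  toℚ (2 * N)                                      ≡⟨ toℚ-* 2 N ⟩
  toℚ 2 Q.* toℚ N                                  ≡⟨ cong (toℚ 2 Q.*_) (expTenthDenom-*-expTenth n) ⟨
  toℚ 2 Q.* (toℚ (expTenthDenom n) Q.* expTenth n) ≡⟨ Q.*-assoc (toℚ 2) (toℚ (expTenthDenom n)) (expTenth n) ⟨
  toℚ 2 Q.* toℚ (expTenthDenom n) Q.* expTenth n   ≡⟨ cong (Q._* expTenth n) (toℚ-* 2 (expTenthDenom n)) ⟨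
  toℚ (2 * expTenthDenom n) Q.* expTenth n         ∎
  where
  open Q.≤-Reasoning
  N = expTenthNumer n

mainTheorem1 : Σ (ℕ → ℕ) λ T →
    (T 0 ≡ 1)
    × ((n : ℕ) → 1 ≤ n → (E : Expr (Fin n)) → HasExactlyVars n E → nodes n E ≡ T n)
    × ((n : ℕ) → 1 ≤ n → T n ≡ 11 + 10 * n * T (n ∸ 1))
    × ((n : ℕ) → 1 ≤ n → 2 * (n !) * 10 ^ n ≤ T n)
    × ((n : ℕ) → 1 ≤ n → ∃[ N ] (toℚ (T n) Q.≤ toℚ (2 * (n !) * 10 ^ n) Q.* expTenth N))
mainTheorem1 =
    gameTreeSize
  , refl
  , (λ n _ E _ → size-maxNode n E)
  , (λ { (suc k) _ → refl })
  , (λ { (suc m) _ → subst (_≤ gameTreeSize (suc m)) (2*expTenthDenom≡2*!*10^ (suc m))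
                             (2*expTenthDenom≤gameTreeSize m) })
  , (λ n _ → n , subst (λ x → toℚ (gameTreeSize n) Q.≤ toℚ x Q.* expTenth n) (2*expTenthDenom≡2*!*10^ n)
                       (gameTreeSize≤expTenthBound n))
  where
  2*expTenthDenom≡2*!*10^ : ∀ n → 2 * expTenthDenom n ≡ 2 * (n !) * 10 ^ n
  2*expTenthDenom≡2*!*10^ n = trans (cong (2 *_) (expTenthDenom≡!*10^ n)) (sym (*-assoc 2 (n !) (10 ^ n)))
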